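{- Let $d$ be a degree sequence and let $R_1,R_2,R_3,R_4$ be four distinct labeled realizations of $d$ that are pairwise adjacent in the realization graph $\mathcal{G}(d)$. For $I\subseteq\{1,2,3,4\}$ let $s_I$ denote the number of vertex pairs that are edges in $R_i$ for every $i\in I$ and are non-edges in $R_j$ for every $j\notin I$. If $i,j,k$ are distinct elements of $\{1,2,3,4\}$, $A=\{i,j\}$ and $B=\{i,k\}$, then $s_A+s_B\le 1$.
   Context: All graphs are finite and simple. A labeled realization of a degree sequence $d=(d_1,\dots,d_n)$ is a graph on the fixed vertex set $\{v_1,\dots,v_n\}$ in which $v_i$ has degree $d_i$. An alternating 4-cycle $[u,v:w,x]$ in a graph $H$ consists of four distinct vertices $u,v,w,x$ with $uv,wx\in E(H)$ and $ux,vw\notin E(H)$. A 2-switch on it deletes $uv,wx$ and adds $ux,vw$. The realization graph $\mathcal{G}(d)$ has the labeled realizations of $d$ as vertices, two being adjacent when one is obtained from the other by a single 2-switch. -}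

module Defs where

open import Data.Nat using (ℕ; _+_; _<_; _≤_)
open import Data.Bool using (Bool; true; false; if_then_else_; _∧_; _∨_; not)
import Data.Bool as B
open import Data.Fin using (Fin; toℕ; _≟_)
open import Data.List using (List; allFin; map; concatMap; filter; length)
open import Data.Nat.ListAction using (sum)
open import Data.Product using (_×_; Σ; ∃; _,_)
open import Data.Sum using (_⊎_)
open import Relation.Binary.PropositionalEquality using (_≡_; _≢_)
open import Relation.Nullary using (¬_)
open import Relation.Nullary.Decidable using (⌊_⌋)
open import Data.Nat using (_<?_)

record Graph (n : ℕ) : Set where
  field
    adj    : Fin n → Fin n → Bool
    sym    : ∀ a b → adj a b ≡ adj b a
    irrefl : ∀ a → adj a a ≡ false
open Graph public

countL : {A : Set} → (A → Bool) → List A → ℕ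
countL p xs = sum (map (λ x → if p x then 1 else 0) xs)

degree : {n : ℕ} → Graph n → Fin n → ℕ
degree G i = countL (λ j → adj G i j) (allFin _)

IsRealization : {n : ℕ} → (Fin n → ℕ) → Graph n → Set
IsRealization d G = ∀ i → degree G i ≡ d i

samePair : {n : ℕ} → Fin n → Fin n → Fin n → Fin n → Bool
samePair a b u v = (⌊ a ≟ u ⌋ ∧ ⌊ b ≟ v ⌋) ∨ (⌊ a ≟ v ⌋ ∧ ⌊ b ≟ u ⌋)

-- adjacency after the 2-switch on [u,v:w,x]: delete uv, wx; add ux, vw
switchAdj : {n : ℕ} → Graph n → Fin n → Fin n → Fin n → Fin n → Fin n → Fin n → Bool
switchAdj G u v w x a b =
  if samePair a b u v ∨ samePair a b w x then false
  else if samePair a b u x ∨ samePair a b v w then true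
  else adj G a b

AltCycle : {n : ℕ} → Graph n → Fin n → Fin n → Fin n → Fin n → Set
AltCycle G u v w x =
  u ≢ v × u ≢ w × u ≢ x × v ≢ w × v ≢ x × w ≢ x ×
  adj G u v ≡ true × adj G w x ≡ true × adj G u x ≡ false × adj G v w ≡ false

TwoSwitch : {n : ℕ} → Graph n → Graph n → Set
TwoSwitch {n} G H = Σ (Fin n) λ u → Σ (Fin n) λ v → Σ (Fin n) λ w → Σ (Fin n) λ x →
  AltCycle G u v w x × (∀ a b → adj H a b ≡ switchAdj G u v w x a b)

AdjacentRG : {n : ℕ} → Graph n → Graph n → Set
AdjacentRG G H = TwoSwitch G H ⊎ TwoSwitch H G

SameGraph : {n : ℕ} → Graph n → Graph n → Set
SameGraph G H = ∀ a b → adj G a b ≡ adj H a b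

-- all unordered vertex pairs {a,b}, listed as (a,b) with a < b
pairs : (n : ℕ) → List (Fin n × Fin n)
pairs n = concatMap (λ a → map (λ b → (a , b)) (filter (λ b → toℕ a <? toℕ b) (allFin n))) (allFin n)

-- s_I for a family R of four graphs and I ⊆ {1,..,4} given as indicator Fin 4 → Bool:
-- number of pairs that are edges in R t exactly for t ∈ I
sI : {n : ℕ} → (Fin 4 → Graph n) → (Fin 4 → Bool) → ℕ
sI {n} R I = countL (λ p → matchesI (Data.Product.proj₁ p) (Data.Product.proj₂ p)) (pairs n)
  where
    matchesI : Fin n → Fin n → Bool
    matchesI a b = Data.List.foldr _∧_ true
      (map (λ t → ⌊ adj (R t) a b B.≟ I t ⌋) (allFin 4))

pairSet : Fin 4 → Fin 4 → Fin 4 → Bool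
pairSet i j t = ⌊ t ≟ i ⌋ ∨ ⌊ t ≟ j ⌋

-- Let l be the fourth index and R_i → R_l the 2-switch [u,v:w,x]. A pair counted by s_A or s_B
-- is an edge of R_i and a non-edge of R_l, hence uv or wx, and R_j and R_k disagree on it; so it
-- suffices that R_j and R_k agree on uv or on wx. If R_j has one of them and R_k the other, the
-- switch between R_j and R_k removes a pair and adds a disjoint one, whereas in a 2-switch every
-- removed pair meets every added pair. If R_j has both and R_k neither, then R_i → R_k and
-- R_j → R_l both remove exactly uv and wx, and add either ux, vw (making R_k = R_l, resp.
-- R_j = R_i) or uw, vx; if both add uw, vx, then uw lies in R_l but not in R_i.
module Submission where

open import Defs renaming (sym to adj-sym)
open import Data.Bool using (Bool; true; false; _∧_; _∨_; if_then_else_)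
import Data.Bool as Bool
open import Data.Bool.Properties using (T-≡; ∨-zeroʳ)
open import Data.Empty using (⊥; ⊥-elim)
open import Data.Fin using (Fin; zero; toℕ; _≟_; punchIn; punchOut)
open import Data.Fin.Properties
  using (punchInᵢ≢i; punchIn-injective; punchIn-punchOut; punchOut-injective)
open import Data.List using (List; []; _∷_; map; filter; allFin; foldr)
open import Data.List.Membership.Propositional using (_∈_)
open import Data.List.Membership.Propositional.Properties
  using (∈-map⁺; ∈-map⁻; ∈-filter⁻; ∈-concat⁻′; ∈-allFin)
open import Data.List.Relation.Unary.All using (All; []; _∷_)
import Data.List.Relation.Unary.All as All
open import Data.List.Relation.Unary.Any using (here; there)
import Data.List.Relation.Unary.AllPairs as AllPairs
import Data.List.Relation.Unary.AllPairs.Properties as AllPairs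
open import Data.List.Relation.Unary.Unique.Propositional using (Unique; _∷_)
import Data.List.Relation.Unary.Unique.Propositional.Properties as Unique
open import Data.List.Relation.Binary.Disjoint.Propositional using (Disjoint)
open import Data.Nat using (ℕ; suc; _+_; _≤_; _<_; z≤n; s≤s; _<?_)
open import Data.Nat.Properties using (+-suc; <-asym; ≤-reflexive; module ≤-Reasoning)
open import Data.Product using (_×_; _,_; proj₁; proj₂; ∃; ∃₂)
open import Data.Sum using (_⊎_; inj₁; inj₂)
import Data.Sum as Sum
open import Function using (_∘_)
open import Function.Bundles using (Equivalence)
open import Relation.Binary.PropositionalEquality
  using (_≡_; _≢_; ≢-sym; refl; sym; trans; cong; cong₂)
open import Relation.Nullary using (¬_; Dec; yes; no; does; contradiction)
open import Relation.Nullary.Decidable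
  using (⌊_⌋; _×-dec_; _⊎-dec_; dec-true; dec-false; isYes≗does; toWitness)

private
  variable
    n : ℕ
    a b c d p q r s : Fin n
    G H K : Graph n

⌊⌋≡true⇒ : {A : Set} (a? : Dec A) → ⌊ a? ⌋ ≡ true → A
⌊⌋≡true⇒ a? e = toWitness (Equivalence.from T-≡ e)

⌊⌋≡true : {A : Set} (a? : Dec A) → A → ⌊ a? ⌋ ≡ true
⌊⌋≡true a? p = trans (isYes≗does a?) (dec-true a? p)

⌊⌋≡false : {A : Set} (a? : Dec A) → ¬ A → ⌊ a? ⌋ ≡ false
⌊⌋≡false a? ¬p = trans (isYes≗does a?) (dec-false a? ¬p)

∨-true : ∀ {p q} → p ∨ q ≡ true → p ≡ true ⊎ q ≡ true
∨-true {true}  _ = inj₁ refl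
∨-true {false} e = inj₂ e

and-true : ∀ {bs} → foldr _∧_ true bs ≡ true → ∀ {β} → β ∈ bs → β ≡ true
and-true {true ∷ _} _ (here refl) = refl
and-true {true ∷ _} e (there β∈) = and-true e β∈

countL-∨ : {A : Set} (p q : A → Bool) (xs : List A) →
  (∀ y → p y ≡ true → q y ≡ true → ⊥) →
  countL p xs + countL q xs ≡ countL (λ y → p y ∨ q y) xs
countL-∨ p q [] _ = refl
countL-∨ p q (y ∷ xs) disjoint with p y in py | q y in qy
... | true  | true  = ⊥-elim (disjoint y py qy)
... | true  | false = cong suc (countL-∨ p q xs disjoint)
... | false | true  = trans (+-suc _ _) (cong suc (countL-∨ p q xs disjoint))
... | false | false = countL-∨ p q xs disjoint

countL-≡0 : {A : Set} (p : A → Bool) (xs : List A) →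
  (∀ {y} → y ∈ xs → p y ≢ true) → countL p xs ≡ 0
countL-≡0 p [] _ = refl
countL-≡0 p (y ∷ xs) none with p y in py
... | true  = contradiction py (none (here refl))
... | false = countL-≡0 p xs (none ∘ there)

countL-≤1 : {A : Set} (p : A → Bool) {xs : List A} → Unique xs →
  (∀ {y z} → y ∈ xs → z ∈ xs → p y ≡ true → p z ≡ true → y ≡ z) →
  countL p xs ≤ 1
countL-≤1 p {[]} _ _ = z≤n
countL-≤1 p {y ∷ xs} (y∉xs ∷ unique) atMostOne with p y in py
... | true  = s≤s (≤-reflexive (countL-≡0 p xs λ z∈ pz →
                All.lookup y∉xs z∈ (atMostOne (here refl) (there z∈) py pz)))
... | false = countL-≤1 p unique (λ y∈ z∈ → atMostOne (there y∈) (there z∈))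

row : (n : ℕ) → Fin n → List (Fin n × Fin n)
row n a = map (a ,_) (filter (λ b → toℕ a <? toℕ b) (allFin n))

pairs-unique : (n : ℕ) → Unique (pairs n)
pairs-unique n = Unique.concat⁺ (rows-unique (allFin n))
  (AllPairs.map⁺ (AllPairs.map rows-disjoint (Unique.allFin⁺ n)))
  where
  rows-unique : (as : List (Fin n)) → All Unique (map (row n) as)
  rows-unique [] = []
  rows-unique (a ∷ as) =
    Unique.map⁺ (cong proj₂) (Unique.filter⁺ (λ b → toℕ a <? toℕ b) (Unique.allFin⁺ n))
    ∷ rows-unique as
  row-proj₁ : ∀ {a e} → e ∈ row n a → proj₁ e ≡ a
  row-proj₁ {a} e∈ with ∈-map⁻ (a ,_) e∈
  ... | _ , _ , refl = refl
  rows-disjoint : ∀ {a a′} → a ≢ a′ → Disjoint (row n a) (row n a′)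
  rows-disjoint a≢a′ (e∈ , e∈′) = a≢a′ (trans (sym (row-proj₁ e∈)) (row-proj₁ e∈′))

pairs-< : (a , b) ∈ pairs n → toℕ a < toℕ b
pairs-< {n} e∈ with ∈-concat⁻′ (map (row n) (allFin n)) e∈
... | _ , e∈row , row∈ with ∈-map⁻ (row n) row∈
... | a , _ , refl with ∈-map⁻ (a ,_) e∈row
... | b , b∈ , refl = proj₂ (∈-filter⁻ (λ b → toℕ a <? toℕ b) {xs = allFin n} b∈)

SamePair : Fin n → Fin n → Fin n → Fin n → Set
SamePair a b p q = (a ≡ p × b ≡ q) ⊎ (a ≡ q × b ≡ p)

samePair? : (a b p q : Fin n) → Dec (SamePair a b p q)
samePair? a b p q = (a ≟ p ×-dec b ≟ q) ⊎-dec (a ≟ q ×-dec b ≟ p)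

samePair≡does : (a b p q : Fin n) → samePair a b p q ≡ does (samePair? a b p q)
samePair≡does a b p q = cong₂ _∨_
  (cong₂ _∧_ (isYes≗does (a ≟ p)) (isYes≗does (b ≟ q)))
  (cong₂ _∧_ (isYes≗does (a ≟ q)) (isYes≗does (b ≟ p)))

SamePair-flip : SamePair a b p q → SamePair a b q p
SamePair-flip = Sum.swap

SamePair-adj : (G : Graph n) → SamePair a b p q → adj G a b ≡ adj G p q
SamePair-adj G (inj₁ (refl , refl)) = refl
SamePair-adj G (inj₂ (refl , refl)) = adj-sym G _ _

SamePair-agree : (G H : Graph n) → SamePair a b p q →
  adj G p q ≡ adj H p q → adj G a b ≡ adj H a b
SamePair-agree G H ab=pq pq-agree =
  trans (SamePair-adj G ab=pq) (trans pq-agree (sym (SamePair-adj H ab=pq)))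

pairs-SamePair : (a , b) ∈ pairs n → (c , d) ∈ pairs n →
  SamePair a b p q → SamePair c d p q → (a , b) ≡ (c , d)
pairs-SamePair _  _  (inj₁ (refl , refl)) (inj₁ (refl , refl)) = refl
pairs-SamePair _  _  (inj₂ (refl , refl)) (inj₂ (refl , refl)) = refl
pairs-SamePair ∈₁ ∈₂ (inj₁ (refl , refl)) (inj₂ (refl , refl)) =
  ⊥-elim (<-asym (pairs-< ∈₁) (pairs-< ∈₂))
pairs-SamePair ∈₁ ∈₂ (inj₂ (refl , refl)) (inj₁ (refl , refl)) =
  ⊥-elim (<-asym (pairs-< ∈₁) (pairs-< ∈₂))

OneOf : Fin n → Fin n → Fin n → Fin n → Fin n → Fin n → Set
OneOf a b p q r s = SamePair a b p q ⊎ SamePair a b r s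

oneOf? : (a b p q r s : Fin n) → Dec (OneOf a b p q r s)
oneOf? a b p q r s = samePair? a b p q ⊎-dec samePair? a b r s

OneOf-flip : OneOf a b p q r s → OneOf a b q p s r
OneOf-flip = Sum.map SamePair-flip SamePair-flip

OneOf-adj : (G : Graph n) {β : Bool} → OneOf a b p q r s →
  adj G p q ≡ β → adj G r s ≡ β → adj G a b ≡ β
OneOf-adj G (inj₁ ab=pq) pq _ = trans (SamePair-adj G ab=pq) pq
OneOf-adj G (inj₂ ab=rs) _ rs = trans (SamePair-adj G ab=rs) rs

switchOutcome : Bool → Bool → Bool → Bool
switchOutcome removed added old = if removed then false else if added then true else old

module _ (G : Graph n) (p q r s a b : Fin n) where

  switchAdj≡ : switchAdj G p q r s a b ≡
    switchOutcome (does (oneOf? a b p q r s)) (does (oneOf? a b p s q r)) (adj G a b)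
  switchAdj≡ = cong₂ (λ removed added → switchOutcome removed added (adj G a b))
    (cong₂ _∨_ (samePair≡does a b p q) (samePair≡does a b r s))
    (cong₂ _∨_ (samePair≡does a b p s) (samePair≡does a b q r))

  switchAdj-removed : OneOf a b p q r s → switchAdj G p q r s a b ≡ false
  switchAdj-removed rem = trans switchAdj≡
    (cong (λ removed → switchOutcome removed (does (oneOf? a b p s q r)) (adj G a b))
      (dec-true (oneOf? a b p q r s) rem))

  switchAdj-added : ¬ OneOf a b p q r s → OneOf a b p s q r → switchAdj G p q r s a b ≡ true
  switchAdj-added ¬rem add = trans switchAdj≡
    (cong₂ (λ removed added → switchOutcome removed added (adj G a b))
      (dec-false (oneOf? a b p q r s) ¬rem) (dec-true (oneOf? a b p s q r) add))

  switchAdj-unchanged : ¬ OneOf a b p q r s → ¬ OneOf a b p s q r →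
    switchAdj G p q r s a b ≡ adj G a b
  switchAdj-unchanged ¬rem ¬add = trans switchAdj≡
    (cong₂ (λ removed added → switchOutcome removed added (adj G a b))
      (dec-false (oneOf? a b p q r s) ¬rem) (dec-false (oneOf? a b p s q r) ¬add))

record Removed (G H : Graph n) (a b : Fin n) : Set where
  constructor removed
  field
    edge-before   : adj G a b ≡ true
    nonedge-after : adj H a b ≡ false

Removed-flip : Removed G H a b → Removed G H b a
Removed-flip {G = G} {H} {a} {b} (removed ab∈G ab∉H) =
  removed (trans (adj-sym G b a) ab∈G) (trans (adj-sym H b a) ab∉H)

compare-adj : (G H : Graph n) (a b : Fin n) →
  adj G a b ≡ adj H a b ⊎ Removed G H a b ⊎ Removed H G a b
compare-adj G H a b with adj G a b in ab∈G | adj H a b in ab∈H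
... | true  | true  = inj₁ refl
... | false | false = inj₁ refl
... | true  | false = inj₂ (inj₁ (removed ab∈G ab∈H))
... | false | true  = inj₂ (inj₂ (removed ab∈H ab∈G))

RemovesExactly : Graph n → Graph n → Fin n → Fin n → Fin n → Fin n → Set
RemovesExactly G H p q r s =
  Removed G H p q × Removed G H r s × (∀ {a b} → Removed G H a b → OneOf a b p q r s)

RemovesExactly-swap : RemovesExactly G H p q r s → RemovesExactly G H r s p q
RemovesExactly-swap (pq , rs , only) = rs , pq , Sum.swap ∘ only

RemovesExactly-flipʳ : RemovesExactly G H p q r s → RemovesExactly G H p q s r
RemovesExactly-flipʳ (pq , rs , only) = pq , Removed-flip rs , Sum.map₂ SamePair-flip ∘ only

RemovesExactly-flip : RemovesExactly G H p q r s → RemovesExactly G H q p s r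
RemovesExactly-flip (pq , rs , only) = Removed-flip pq , Removed-flip rs , OneOf-flip ∘ only

Distinct4 : Fin n → Fin n → Fin n → Fin n → Set
Distinct4 u v w x = u ≢ v × u ≢ w × u ≢ x × v ≢ w × v ≢ x × w ≢ x

Distinct4⇒ps∉pq,rs : Distinct4 p q r s → ¬ OneOf p s p q r s
Distinct4⇒ps∉pq,rs (_   , _   , _   , _ , q≢s , _) (inj₁ (inj₁ (_ , s≡q))) = q≢s (sym s≡q)
Distinct4⇒ps∉pq,rs (p≢q , _   , _   , _ , _   , _) (inj₁ (inj₂ (p≡q , _))) = p≢q p≡q
Distinct4⇒ps∉pq,rs (_   , p≢r , _   , _ , _   , _) (inj₂ (inj₁ (p≡r , _))) = p≢r p≡r
Distinct4⇒ps∉pq,rs (_   , _   , p≢s , _ , _   , _) (inj₂ (inj₂ (p≡s , _))) = p≢s p≡s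

Distinct4⇒qr∉pq,rs : Distinct4 p q r s → ¬ OneOf q r p q r s
Distinct4⇒qr∉pq,rs (p≢q , _   , _ , _   , _   , _) (inj₁ (inj₁ (q≡p , _))) = p≢q (sym q≡p)
Distinct4⇒qr∉pq,rs (_   , p≢r , _ , _   , _   , _) (inj₁ (inj₂ (_ , r≡p))) = p≢r (sym r≡p)
Distinct4⇒qr∉pq,rs (_   , _   , _ , q≢r , _   , _) (inj₂ (inj₁ (q≡r , _))) = q≢r q≡r
Distinct4⇒qr∉pq,rs (_   , _   , _ , _   , q≢s , _) (inj₂ (inj₂ (q≡s , _))) = q≢s q≡s

Distinct4⇒pr∉ps,qr : Distinct4 p q r s → ¬ OneOf p r p s q r
Distinct4⇒pr∉ps,qr (_   , _   , _   , _ , _ , r≢s) (inj₁ (inj₁ (_ , r≡s))) = r≢s r≡s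
Distinct4⇒pr∉ps,qr (_   , _   , p≢s , _ , _ , _  ) (inj₁ (inj₂ (p≡s , _))) = p≢s p≡s
Distinct4⇒pr∉ps,qr (p≢q , _   , _   , _ , _ , _  ) (inj₂ (inj₁ (p≡q , _))) = p≢q p≡q
Distinct4⇒pr∉ps,qr (_   , p≢r , _   , _ , _ , _  ) (inj₂ (inj₂ (p≡r , _))) = p≢r p≡r

record Switch (G H : Graph n) : Set where
  constructor switch
  field
    u v w x  : Fin n
    distinct : Distinct4 u v w x
    removes  : RemovesExactly G H u v w x
    adds     : RemovesExactly H G u x v w

  removed-uv : Removed G H u v
  removed-uv = proj₁ removes

  removed-wx : Removed G H w x
  removed-wx = proj₁ (proj₂ removes)

  added-ux : Removed H G u x
  added-ux = proj₁ adds

  added-vw : Removed H G v w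
  added-vw = proj₁ (proj₂ adds)

  removed⇒ : Removed G H a b → OneOf a b u v w x
  removed⇒ = proj₂ (proj₂ removes)

  added⇒ : Removed H G a b → OneOf a b u x v w
  added⇒ = proj₂ (proj₂ adds)

TwoSwitch⇒Switch : TwoSwitch G H → Switch G H
TwoSwitch⇒Switch {G = G} {H}
  (u , v , w , x , (u≢v , u≢w , u≢x , v≢w , v≢x , w≢x , uv∈G , wx∈G , ux∉G , vw∉G) , H≡) =
  record
  { u = u ; v = v ; w = w ; x = x
  ; distinct = distinct′
  ; removes  = removed uv∈G (H-removed (inj₁ (inj₁ (refl , refl))))
             , removed wx∈G (H-removed (inj₂ (inj₁ (refl , refl))))
             , removed-only
  ; adds     = removed (H-added (Distinct4⇒ps∉pq,rs distinct′) (inj₁ (inj₁ (refl , refl)))) ux∉G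
             , removed (H-added (Distinct4⇒qr∉pq,rs distinct′) (inj₂ (inj₁ (refl , refl)))) vw∉G
             , added-only
  }
  where
  distinct′ : Distinct4 u v w x
  distinct′ = u≢v , u≢w , u≢x , v≢w , v≢x , w≢x
  H-removed : ∀ {a b} → OneOf a b u v w x → adj H a b ≡ false
  H-removed {a} {b} = trans (H≡ a b) ∘ switchAdj-removed G u v w x a b
  H-added : ∀ {a b} → ¬ OneOf a b u v w x → OneOf a b u x v w → adj H a b ≡ true
  H-added {a} {b} ¬rem = trans (H≡ a b) ∘ switchAdj-added G u v w x a b ¬rem
  H-unchanged : ∀ {a b} → ¬ OneOf a b u v w x → ¬ OneOf a b u x v w → adj H a b ≡ adj G a b
  H-unchanged {a} {b} ¬rem = trans (H≡ a b) ∘ switchAdj-unchanged G u v w x a b ¬rem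
  removed-only : ∀ {a b} → Removed G H a b → OneOf a b u v w x
  removed-only {a} {b} (removed ab∈G ab∉H) with oneOf? a b u v w x | oneOf? a b u x v w
  ... | yes rem | _ = rem
  ... | no ¬rem | yes add = contradiction (trans (sym ab∉H) (H-added ¬rem add)) λ ()
  ... | no ¬rem | no ¬add =
    contradiction (trans (sym ab∉H) (trans (H-unchanged ¬rem ¬add) ab∈G)) λ ()
  added-only : ∀ {a b} → Removed H G a b → OneOf a b u x v w
  added-only {a} {b} (removed ab∈H ab∉G) with oneOf? a b u v w x | oneOf? a b u x v w
  ... | no ¬rem | yes add = add
  ... | yes rem | _ = contradiction (trans (sym ab∈H) (H-removed rem)) λ ()
  ... | no ¬rem | no ¬add =
    contradiction (trans (sym ab∉G) (trans (sym (H-unchanged ¬rem ¬add)) ab∈H)) λ ()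

Switch-reverse : Switch G H → Switch H G
Switch-reverse (switch u v w x (u≢v , u≢w , u≢x , v≢w , v≢x , w≢x) removes adds) =
  switch u x w v (u≢x , u≢w , u≢v , w≢x ∘ sym , v≢x ∘ sym , v≢w ∘ sym)
    (RemovesExactly-flipʳ adds) (RemovesExactly-flipʳ removes)

AdjacentRG⇒Switch : AdjacentRG G H → Switch G H
AdjacentRG⇒Switch (inj₁ G→H) = TwoSwitch⇒Switch G→H
AdjacentRG⇒Switch (inj₂ H→G) = Switch-reverse (TwoSwitch⇒Switch H→G)

ShareVertex : Fin n → Fin n → Fin n → Fin n → Set
ShareVertex a b c d = a ≡ c ⊎ a ≡ d ⊎ b ≡ c ⊎ b ≡ d

Distinct4⇒¬ShareVertex : Distinct4 a b c d → ¬ ShareVertex a b c d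
Distinct4⇒¬ShareVertex (_ , a≢c , a≢d , b≢c , b≢d , _) =
  Sum.[ a≢c , Sum.[ a≢d , Sum.[ b≢c , b≢d ]′ ]′ ]′

SamePair-ShareVertex : SamePair a b p q → SamePair c d p r → ShareVertex a b c d
SamePair-ShareVertex (inj₁ (refl , _)) (inj₁ (refl , _)) = inj₁ refl
SamePair-ShareVertex (inj₁ (refl , _)) (inj₂ (_ , refl)) = inj₂ (inj₁ refl)
SamePair-ShareVertex (inj₂ (_ , refl)) (inj₁ (refl , _)) = inj₂ (inj₂ (inj₁ refl))
SamePair-ShareVertex (inj₂ (_ , refl)) (inj₂ (_ , refl)) = inj₂ (inj₂ (inj₂ refl))

removed-added-ShareVertex : Switch G H → Removed G H a b → Removed H G c d → ShareVertex a b c d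
removed-added-ShareVertex σ ab cd with Switch.removed⇒ σ ab | Switch.added⇒ σ cd
... | inj₁ ab=uv | inj₁ cd=ux = SamePair-ShareVertex ab=uv cd=ux
... | inj₁ ab=uv | inj₂ cd=vw = SamePair-ShareVertex (SamePair-flip ab=uv) cd=vw
... | inj₂ ab=wx | inj₁ cd=ux = SamePair-ShareVertex (SamePair-flip ab=wx) (SamePair-flip cd=ux)
... | inj₂ ab=wx | inj₂ cd=vw = SamePair-ShareVertex ab=wx (SamePair-flip cd=vw)

removed-pairs-determine-added : Switch G H → Distinct4 a b c d →
  Removed G H a b → Removed G H c d →
  RemovesExactly H G a d b c ⊎ RemovesExactly H G a c b d
removed-pairs-determine-added σ@(switch _ _ _ _ _ _ adds) abcd ab cd
  with Switch.removed⇒ σ ab | Switch.removed⇒ σ cd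
... | inj₁ ab=uv | inj₁ cd=uv =
  ⊥-elim (Distinct4⇒¬ShareVertex abcd (SamePair-ShareVertex ab=uv cd=uv))
... | inj₂ ab=wx | inj₂ cd=wx =
  ⊥-elim (Distinct4⇒¬ShareVertex abcd (SamePair-ShareVertex ab=wx cd=wx))
... | inj₁ (inj₁ (refl , refl)) | inj₂ (inj₁ (refl , refl)) = inj₁ adds
... | inj₁ (inj₁ (refl , refl)) | inj₂ (inj₂ (refl , refl)) = inj₂ adds
... | inj₁ (inj₂ (refl , refl)) | inj₂ (inj₁ (refl , refl)) = inj₂ (RemovesExactly-swap adds)
... | inj₁ (inj₂ (refl , refl)) | inj₂ (inj₂ (refl , refl)) = inj₁ (RemovesExactly-swap adds)
... | inj₂ (inj₁ (refl , refl)) | inj₁ (inj₁ (refl , refl)) =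
  inj₁ (RemovesExactly-flip (RemovesExactly-swap adds))
... | inj₂ (inj₁ (refl , refl)) | inj₁ (inj₂ (refl , refl)) =
  inj₂ (RemovesExactly-flip (RemovesExactly-swap adds))
... | inj₂ (inj₂ (refl , refl)) | inj₁ (inj₁ (refl , refl)) = inj₂ (RemovesExactly-flip adds)
... | inj₂ (inj₂ (refl , refl)) | inj₁ (inj₂ (refl , refl)) = inj₁ (RemovesExactly-flip adds)

-- Compare both with G: an edge of K missing from H is either removed from G to H (but K lacks
-- those) or added from G to K (but H has those).
¬Removed-through : {p′ q′ r′ s′ : Fin n} →
  RemovesExactly G H p q r s → adj K p q ≡ false → adj K r s ≡ false →
  RemovesExactly K G p′ q′ r′ s′ → adj H p′ q′ ≡ true → adj H r′ s′ ≡ true →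
  ¬ Removed K H a b
¬Removed-through {G = G} {H = H} {K = K} {a = a} {b = b}
  (_ , _ , G→H) pq∉K rs∉K (_ , _ , K→G) p′q′∈H r′s′∈H (removed ab∈K ab∉H)
  with adj G a b in ab∈G
... | true  = contradiction
  (trans (sym ab∈K) (OneOf-adj K (G→H (removed ab∈G ab∉H)) pq∉K rs∉K)) λ ()
... | false = contradiction
  (trans (sym (OneOf-adj H (K→G (removed ab∈K ab∈G)) p′q′∈H r′s′∈H)) ab∉H) λ ()

module _ {Gi Gl : Graph n} (σ : Switch Gi Gl) where
  open Switch σ
  open Removed

  both-vs-neither-impossible : {Gj Gk : Graph n} →
    Switch Gi Gk → Switch Gj Gl → Switch Gk Gl → Switch Gi Gj →
    Removed Gj Gk u v → Removed Gj Gk w x → ⊥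
  both-vs-neither-impossible σik σjl σkl σij (removed uv∈j uv∉k) (removed wx∈j wx∉k)
    with removed-pairs-determine-added σik distinct
           (removed (edge-before removed-uv) uv∉k) (removed (edge-before removed-wx) wx∉k)
  ... | inj₁ k→i-ux,vw =
    ¬Removed-through removes uv∉k wx∉k k→i-ux,vw (edge-before added-ux) (edge-before added-vw)
      (Switch.removed-uv σkl)
  ... | inj₂ k→i-uw,vx
    with removed-pairs-determine-added σjl distinct
           (removed uv∈j (nonedge-after removed-uv)) (removed wx∈j (nonedge-after removed-wx))
  ...   | inj₁ l→j-ux,vw =
    ¬Removed-through l→j-ux,vw (nonedge-after added-ux) (nonedge-after added-vw) removes uv∈j wx∈j
      (Switch.removed-uv σij)
  ...   | inj₂ l→j-uw,vx = Distinct4⇒pr∉ps,qr distinct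
    (added⇒ (removed (edge-before (proj₁ l→j-uw,vx)) (nonedge-after (proj₁ k→i-uw,vx))))

  agree-on-uv-or-wx : {Gj Gk : Graph n} →
    Switch Gi Gj → Switch Gi Gk → Switch Gj Gl → Switch Gk Gl → Switch Gj Gk →
    adj Gj u v ≡ adj Gk u v ⊎ adj Gj w x ≡ adj Gk w x
  agree-on-uv-or-wx {Gj} {Gk} σij σik σjl σkl σjk
    with compare-adj Gj Gk u v | compare-adj Gj Gk w x
  ... | inj₁ uv-agree | _ = inj₁ uv-agree
  ... | _ | inj₁ wx-agree = inj₂ wx-agree
  ... | inj₂ (inj₁ uv-j∖k) | inj₂ (inj₁ wx-j∖k) =
    ⊥-elim (both-vs-neither-impossible σik σjl σkl σij uv-j∖k wx-j∖k)
  ... | inj₂ (inj₂ uv-k∖j) | inj₂ (inj₂ wx-k∖j) =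
    ⊥-elim (both-vs-neither-impossible σij σkl σjl σik uv-k∖j wx-k∖j)
  ... | inj₂ (inj₁ uv-j∖k) | inj₂ (inj₂ wx-k∖j) = ⊥-elim (Distinct4⇒¬ShareVertex distinct
    (removed-added-ShareVertex σjk uv-j∖k wx-k∖j))
  ... | inj₂ (inj₂ uv-k∖j) | inj₂ (inj₁ wx-j∖k) = ⊥-elim (Distinct4⇒¬ShareVertex distinct
    (removed-added-ShareVertex (Switch-reverse σjk) uv-k∖j wx-j∖k))

  disagreements-within-one-pair : {Gj Gk : Graph n} →
    Switch Gi Gj → Switch Gi Gk → Switch Gj Gl → Switch Gk Gl → Switch Gj Gk →
    ∃₂ λ p q → ∀ {a b} → Removed Gi Gl a b → adj Gj a b ≢ adj Gk a b → SamePair a b p q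
  disagreements-within-one-pair {Gj} {Gk} σij σik σjl σkl σjk
    with agree-on-uv-or-wx σij σik σjl σkl σjk
  ... | inj₁ uv-agree = w , x , λ ab disagree →
    Sum.fromInj₂ (λ ab=uv → contradiction (SamePair-agree Gj Gk ab=uv uv-agree) disagree) (removed⇒ ab)
  ... | inj₂ wx-agree = u , v , λ ab disagree →
    Sum.fromInj₁ (λ ab=wx → contradiction (SamePair-agree Gj Gk ab=wx wx-agree) disagree) (removed⇒ ab)

punchIn-≢ : {i j : Fin (suc n)} (i≢j : i ≢ j) {k : Fin n} → k ≢ punchOut i≢j → punchIn i k ≢ j
punchIn-≢ {i = i} i≢j k≢ eq =
  k≢ (punchIn-injective i _ _ (trans eq (sym (punchIn-punchOut i≢j))))

fresh-of-three : (i j k : Fin (suc (suc (suc (suc n))))) →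
  i ≢ j → i ≢ k → j ≢ k → ∃ λ l → l ≢ i × l ≢ j × l ≢ k
fresh-of-three i j k i≢j i≢k j≢k =
  punchIn i l′ , punchInᵢ≢i i l′ , punchIn-≢ i≢j l′≢j′ , punchIn-≢ i≢k l′≢k′
  where
  j′≢k′ : punchOut i≢j ≢ punchOut i≢k
  j′≢k′ = j≢k ∘ punchOut-injective i≢j i≢k
  l′ = punchIn (punchOut i≢j) (punchIn (punchOut j′≢k′) zero)
  l′≢j′ : l′ ≢ punchOut i≢j
  l′≢j′ = punchInᵢ≢i _ _
  l′≢k′ : l′ ≢ punchOut i≢k
  l′≢k′ = punchIn-≢ j′≢k′ (punchInᵢ≢i _ zero)

-- The predicate counted by sI, which Defs defines locally.
matches : (Fin 4 → Graph n) → (Fin 4 → Bool) → Fin n → Fin n → Bool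
matches R I a b = foldr _∧_ true (map (λ t → ⌊ adj (R t) a b Bool.≟ I t ⌋) (allFin 4))

matches-adj : (R : Fin 4 → Graph n) (I : Fin 4 → Bool) → matches R I a b ≡ true →
  ∀ t → adj (R t) a b ≡ I t
matches-adj {a = a} {b} R I m t = ⌊⌋≡true⇒ (adj (R t) a b Bool.≟ I t)
  (and-true m (∈-map⁺ (λ t → ⌊ adj (R t) a b Bool.≟ I t ⌋) (∈-allFin t)))

pairSet-left : (i j : Fin 4) → pairSet i j i ≡ true
pairSet-left i j = cong (_∨ ⌊ i ≟ j ⌋) (⌊⌋≡true (i ≟ i) refl)

pairSet-right : (i j : Fin 4) → pairSet i j j ≡ true
pairSet-right i j = trans (cong (⌊ j ≟ i ⌋ ∨_) (⌊⌋≡true (j ≟ j) refl)) (∨-zeroʳ _)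

pairSet-outside : {i j t : Fin 4} → t ≢ i → t ≢ j → pairSet i j t ≡ false
pairSet-outside {i} {j} {t} t≢i t≢j =
  cong₂ _∨_ (⌊⌋≡false (t ≟ i) t≢i) (⌊⌋≡false (t ≟ j) t≢j)

module _ (R : Fin 4 → Graph n) (i j : Fin 4) where

  matches-pairSet-inside : matches R (pairSet i j) a b ≡ true →
    adj (R i) a b ≡ true × adj (R j) a b ≡ true
  matches-pairSet-inside m = trans (matches-adj R (pairSet i j) m i) (pairSet-left i j)
                           , trans (matches-adj R (pairSet i j) m j) (pairSet-right i j)

  matches-pairSet-outside : {t : Fin 4} → t ≢ i → t ≢ j → matches R (pairSet i j) a b ≡ true →
    adj (R t) a b ≡ false
  matches-pairSet-outside {t = t} t≢i t≢j m =
    trans (matches-adj R (pairSet i j) m t) (pairSet-outside t≢i t≢j)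

  matches-pairSet⇒Removed : {k l : Fin 4} → k ≢ i → k ≢ j → l ≢ i → l ≢ j →
    matches R (pairSet i j) a b ≡ true → Removed (R i) (R l) a b × adj (R j) a b ≢ adj (R k) a b
  matches-pairSet⇒Removed k≢i k≢j l≢i l≢j m =
    removed (proj₁ (matches-pairSet-inside m)) (matches-pairSet-outside l≢i l≢j m) ,
    λ jk → contradiction
      (trans (sym (proj₂ (matches-pairSet-inside m))) (trans jk (matches-pairSet-outside k≢i k≢j m))) λ ()

matches-pairSet-disjoint : (R : Fin 4 → Graph n) {i j k : Fin 4} → j ≢ i → j ≢ k →
  matches R (pairSet i j) a b ≡ true → matches R (pairSet i k) a b ≡ true → ⊥
matches-pairSet-disjoint R {i} {j} {k} j≢i j≢k mj mk = contradiction
  (trans (sym (proj₂ (matches-pairSet-inside R i j mj))) (matches-pairSet-outside R i k j≢i j≢k mk))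
  λ ()

counted-within-one-pair : (R : Fin 4 → Graph n) → (∀ s t → s ≢ t → Switch (R s) (R t)) →
  {i j k l : Fin 4} → i ≢ j → i ≢ k → j ≢ k → l ≢ i → l ≢ j → l ≢ k →
  ∃₂ λ p q → ∀ a b → (matches R (pairSet i j) a b ∨ matches R (pairSet i k) a b) ≡ true →
    SamePair a b p q
counted-within-one-pair R σ {i} {j} {k} {l} i≢j i≢k j≢k l≢i l≢j l≢k
  with disagreements-within-one-pair (σ i l (≢-sym l≢i))
         (σ i j i≢j) (σ i k i≢k) (σ j l (≢-sym l≢j)) (σ k l (≢-sym l≢k)) (σ j k j≢k)
... | p , q , within = p , q , counted⇒SamePair
  where
  counted⇒SamePair : ∀ a b → (matches R (pairSet i j) a b ∨ matches R (pairSet i k) a b) ≡ true →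
    SamePair a b p q
  counted⇒SamePair a b counted with ∨-true {matches R (pairSet i j) a b} counted
  ... | inj₁ mj =
    let ab , disagree = matches-pairSet⇒Removed R i j (≢-sym i≢k) (≢-sym j≢k) l≢i l≢j mj
    in within ab disagree
  ... | inj₂ mk =
    let ab , disagree = matches-pairSet⇒Removed R i k (≢-sym i≢j) j≢k l≢i l≢k mk
    in within ab (disagree ∘ sym)

lemma5 : (n : ℕ) (d : Fin n → ℕ) (R : Fin 4 → Graph n) →
    (∀ t → IsRealization d (R t)) →
    (∀ s t → s ≢ t → ¬ SameGraph (R s) (R t)) →
    (∀ s t → s ≢ t → AdjacentRG (R s) (R t)) →
    (i j k : Fin 4) → i ≢ j → i ≢ k → j ≢ k →
    sI R (pairSet i j) + sI R (pairSet i k) ≤ 1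
lemma5 n _ R _ _ adjacent i j k i≢j i≢k j≢k with fresh-of-three i j k i≢j i≢k j≢k
... | l , l≢i , l≢j , l≢k
  with counted-within-one-pair R (λ s t → AdjacentRG⇒Switch ∘ adjacent s t)
         i≢j i≢k j≢k l≢i l≢j l≢k
... | p , q , within = begin
    sI R (pairSet i j) + sI R (pairSet i k)
      ≡⟨ countL-∨ inA inB (pairs n) (λ _ → matches-pairSet-disjoint R (≢-sym i≢j) j≢k) ⟩
    countL (λ e → inA e ∨ inB e) (pairs n)
      ≤⟨ countL-≤1 _ (pairs-unique n) (λ {(a , b)} {(c , d)} ab∈ cd∈ ab-in cd-in →
           pairs-SamePair ab∈ cd∈ (within a b ab-in) (within c d cd-in)) ⟩
    1 ∎
  where
  open ≤-Reasoning
  inA inB : Fin n × Fin n → Bool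
  inA (a , b) = matches R (pairSet i j) a b
  inB (a , b) = matches R (pairSet i k) a b
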